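{- For all reasons $r,s\in R$ and every formula $\varphi\in F$: $\mathsf{RBB}\vdash (Br\land Bs)\to(r:\varphi\to\neg s:\neg\varphi)$.
   Context: $P$ (propositional letters) and $R$ (reason symbols) are nonempty sets. $F$: $\varphi ::= p \mid \neg\varphi \mid (\varphi\lor\varphi) \mid (r:\varphi) \mid r \mid B\varphi$, $p\in P$, $r\in R$; the colon binds more strongly than Boolean connectives. $\mathsf{RBB}$ has axiom schemes (CL) classical propositional tautologies; (RK) $r:(\varphi\to\psi)\to(r:\varphi\to r:\psi)$; (A) $r:\varphi\to(r\to\varphi)$; (RB) $r:\varphi\to(Br\to B\varphi)$; (D) $B\varphi\to\neg B\neg\varphi$; rules (MP) modus ponens, (RN) from $\varphi$ infer $r:\varphi$, (E) from $\varphi\leftrightarrow\psi$ infer $B\varphi\leftrightarrow B\psi$. -}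

module Defs where

open import Data.Bool using (Bool; true; false; not; _∨_)
open import Relation.Binary.PropositionalEquality using (_≡_)

module Language (P R : Set) where

  infix 30 _∶_
  data Form : Set where
    var  : P → Form
    ¬'_  : Form → Form
    _∨'_ : Form → Form → Form
    _∶_  : R → Form → Form
    rsn  : R → Form
    B    : Form → Form

  _∧'_ : Form → Form → Form
  φ ∧' ψ = ¬' ((¬' φ) ∨' (¬' ψ))

  _⇒_ : Form → Form → Form
  φ ⇒ ψ = (¬' φ) ∨' ψ

  _⇔_ : Form → Form → Form
  φ ⇔ ψ = (φ ⇒ ψ) ∧' (ψ ⇒ φ)

  -- Classical propositional tautologies: formulas true under every
  -- Boolean valuation that treats p, r:φ, r and Bφ as propositional atoms.
  record Valuation : Set where
    field
      vvar : P → Bool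
      vjus : R → Form → Bool
      vrsn : R → Bool
      vB   : Form → Bool

  eval : Valuation → Form → Bool
  eval v (var p)   = Valuation.vvar v p
  eval v (¬' φ)    = not (eval v φ)
  eval v (φ ∨' ψ)  = eval v φ ∨ eval v ψ
  eval v (r ∶ φ)   = Valuation.vjus v r φ
  eval v (rsn r)   = Valuation.vrsn v r
  eval v (B φ)     = Valuation.vB v φ

  Tautology : Form → Set
  Tautology φ = (v : Valuation) → eval v φ ≡ true

  infix 5 ⊢_
  data ⊢_ : Form → Set where
    CL : ∀ {φ} → Tautology φ → ⊢ φ
    RK : ∀ {r φ ψ} → ⊢ (r ∶ (φ ⇒ ψ)) ⇒ ((r ∶ φ) ⇒ (r ∶ ψ))
    A  : ∀ {r φ} → ⊢ (r ∶ φ) ⇒ (rsn r ⇒ φ)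
    RB : ∀ {r φ} → ⊢ (r ∶ φ) ⇒ (B (rsn r) ⇒ B φ)
    D  : ∀ {φ} → ⊢ B φ ⇒ (¬' (B (¬' φ)))
    MP : ∀ {φ ψ} → ⊢ φ ⇒ ψ → ⊢ φ → ⊢ ψ
    RN : ∀ {r φ} → ⊢ φ → ⊢ r ∶ φ
    E  : ∀ {φ ψ} → ⊢ φ ⇔ ψ → ⊢ B φ ⇔ B ψ

module Submission where

-- If B r and B s hold, axiom (RB) turns r:φ into Bφ and s:¬φ into B¬φ,
-- and axiom (D) forbids believing both φ and ¬φ.  The conclusion is thus a
-- truth-functional consequence of three axiom instances, (RB) for r and φ,
-- (RB) for s and ¬φ, and (D) for φ, treating r:φ, s:¬φ, Br, Bs, Bφ and
-- B¬φ as propositional atoms.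

open import Defs
open import Data.Bool using (Bool; true; false; not; _∨_)
open import Relation.Binary.PropositionalEquality using (_≡_; refl)

-- A material implication is true whenever truth of the antecedent forces
-- truth of the consequent; this is how semantic entailment becomes (CL).
implication-true : (x y : Bool) → (x ≡ true → y ≡ true) → not x ∨ y ≡ true
implication-true false y _ = refl
implication-true true  y h = h refl

-- The Boolean core of the argument, with a = r:φ, b = Br, c = Bφ,
-- d = s:¬φ, e = Bs, f = B¬φ: the two (RB) instances, the (D) instance
-- and the conclusion  (b ∧ e) → (¬a ∨ ¬d)  written with ¬ and ∨ only.
-- Only when a, b, d, e are all true can the conclusion fail, and then the
-- (RB) instances force c and f, which the (D) instance excludes.
believed-reasons-consistent :
  (a b c d e f : Bool) →
  not a ∨ (not b ∨ c) ≡ true →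
  not d ∨ (not e ∨ f) ≡ true →
  not c ∨ not f ≡ true →
  not (not (not b ∨ not e)) ∨ (not a ∨ not d) ≡ true
believed-reasons-consistent a     false c     d     e     f     _    _    _ = refl
believed-reasons-consistent a     true  c     d     false f     _    _    _ = refl
believed-reasons-consistent false true  c     d     true  f     _    _    _ = refl
believed-reasons-consistent true  true  c     false true  f     _    _    _ = refl
believed-reasons-consistent true  true  .true true  true  .true refl refl ()

module PropositionalConsequence (P R : Set) where
  open Language P R

  consequence₃ : {χ₁ χ₂ χ₃ ψ : Form} →
    ((v : Valuation) → eval v χ₁ ≡ true → eval v χ₂ ≡ true →
                       eval v χ₃ ≡ true → eval v ψ ≡ true) →
    ⊢ χ₁ → ⊢ χ₂ → ⊢ χ₃ → ⊢ ψ
  consequence₃ {χ₁} {χ₂} {χ₃} {ψ} entails ⊢χ₁ ⊢χ₂ ⊢χ₃ =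
    MP (MP (MP (CL nested) ⊢χ₁) ⊢χ₂) ⊢χ₃
    where
    nested : Tautology (χ₁ ⇒ (χ₂ ⇒ (χ₃ ⇒ ψ)))
    nested v = implication-true _ _ λ h₁ → implication-true _ _ λ h₂ →
               implication-true _ _ λ h₃ → entails v h₁ h₂ h₃

mainTheorem13 : (P R : Set) → P → R → let open Language P R in
    (r s : R) (φ : Form) → ⊢ (B (rsn r) ∧' B (rsn s)) ⇒ ((r ∶ φ) ⇒ (¬' (s ∶ (¬' φ))))
mainTheorem13 P R _ _ r s φ =
  consequence₃ (λ v → believed-reasons-consistent
                  (Valuation.vjus v r φ) (Valuation.vB v (rsn r)) (Valuation.vB v φ)
                  (Valuation.vjus v s (¬' φ)) (Valuation.vB v (rsn s)) (Valuation.vB v (¬' φ)))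
    (RB {r} {φ})
    (RB {s} {¬' φ})
    (D {φ})
  where
  open Language P R
  open PropositionalConsequence P R
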